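{- Let $r=s=1$, let $n$ be a positive integer, let $\sigma_0=(-n,0,0)\in\mathbf{Rec}$, and let $\sigma_t=(x(t),y(t),z(t))=f_{1,1}(\sigma_{t-1})$ for $t\ge1$. Then for all $t\ge0$, $$x(t)^2-y(t)^2<n^2+n\qquad\text{and}\qquad (x(t)-1)^2-(y(t)-1)^2>n^2.$$
   Context: Fix positive integers $r,s$ (here $r=s=1$). In the one-dimensional generalized rotor-router model, a particle starts at $0$, at each occupied site moves left if the label there is $L$ and right if it is $R$, then flips that label; on first reaching an unoccupied site to the left (resp. right) of the occupied interval, $r$ (resp. $s$) new consecutive sites on that side become occupied, labeled $R$; this defines $f_{r,s}$. Recurrent states are identified with integer triples $(x,y,z)$, $x\le0\le y$, $x\le z\le y$ (the state with occupied interval $[x,y+s-1]$, labels $R$ on $[x,z-1]$, $L$ on $[z,y-1]$, $R$ on $[y,y+s-1]$); on them $f_{r,s}(x,y,z)=(x,y+s,z-y)$ if $x+y\le z$ and $f_{r,s}(x,y,z)=(x-r,y,z-x+1)$ if $x+y>z$. Thus $(-n,0,0)$ for $r=s=1$ is the state with occupied interval $[-n,0]$, all labeled $R$. -}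

module Defs where

open import Data.Nat using (ℕ; zero; suc)
open import Data.Integer using (ℤ; +_; -_; _+_; _-_; _≤?_)
open import Data.Product using (_×_; _,_)
open import Relation.Nullary using (yes; no)

State : Set
State = ℤ × ℤ × ℤ

f : ℕ → ℕ → State → State
f r s (x , y , z) with (x + y) ≤? z
... | yes _ = (x , y + + s , z - y)
... | no  _ = (x - + r , y , z - x + + 1)

σ : ℕ → ℕ → State
σ n zero    = (- (+ n) , + 0 , + 0)
σ n (suc t) = f 1 1 (σ n t)

-- Write a state as x = -A, y = B, z = d + x + y, so the walk moves right when d ≥ 0 and left
-- when d < 0.  Along the orbit 2d = A² + 3A - B² - B - n² - n, -B ≤ d ≤ A and A ≤ n + B; when
-- A = n + B the identity forces d > 0, so the last bound survives a left move.  Each inequality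
-- is the identity plus the two bounds on d, with the borderline cases A ≤ B, resp. A = n + B,
-- treated separately.
module Submission where

open import Defs
open import Data.Nat using (ℕ; NonZero)
open import Data.Integer using (ℤ; +_; _+_; _-_; _*_; _<_; _>_)
open import Data.Product using (_×_; _,_)

open import Data.Empty using (⊥-elim)
open import Data.Integer using (-_; -[1+_]; 0ℤ; _≤_; _≤?_; +≤+; +<+; -<+)
import Data.Integer.Properties as ℤ
open import Data.Integer.Tactic.RingSolver using (solve-∀)
import Data.Nat as ℕ
import Data.Nat.Properties as ℕ
open import Data.Product using (∃-syntax)
open import Data.Sum using (inj₁; inj₂)
open import Relation.Binary.PropositionalEquality
open import Relation.Nullary using (yes; no)

f-right : ∀ r s {x y z} → x + y ≤ z → f r s (x , y , z) ≡ (x , y + + s , z - y)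
f-right r s {x} {y} {z} x+y≤z with x + y ≤? z
... | yes _    = refl
... | no x+y≰z = ⊥-elim (x+y≰z x+y≤z)

f-left : ∀ r s {x y z} → z < x + y → f r s (x , y , z) ≡ (x - + r , y , z - x + + 1)
f-left r s {x} {y} {z} z<x+y with x + y ≤? z
... | yes x+y≤z = ⊥-elim (ℤ.<⇒≱ z<x+y x+y≤z)
... | no _      = refl

i<j⇒0<j-i : ∀ {i j} → i < j → 0ℤ < j - i
i<j⇒0<j-i {i} {j} i<j = begin-strict
  0ℤ     ≡⟨ sym (ℤ.+-inverseʳ i) ⟩
  i - i  <⟨ ℤ.+-monoˡ-< (- i) i<j ⟩
  j - i  ∎
  where open ℤ.≤-Reasoning

<-of-positive-gap : ∀ {a b c} → b ≡ a + c → 0ℤ < c → a < b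
<-of-positive-gap {a} {b} {c} b≡a+c 0<c = begin-strict
  a       ≡⟨ sym (ℤ.+-identityʳ a) ⟩
  a + 0ℤ  <⟨ ℤ.+-monoʳ-< a 0<c ⟩
  a + c   ≡⟨ sym b≡a+c ⟩
  b       ∎
  where open ℤ.≤-Reasoning

-- Occupied interval [-A, B]; the sign of d = z - (x + y) decides the next move.
config : ℕ → ℕ → ℤ → State
config A B d = (- + A , + B , d + (- + A + + B))

-[1+k]+i<i : ∀ k i → -[1+ k ] + i < i
-[1+k]+i<i k i = subst (-[1+ k ] + i <_) (ℤ.+-identityˡ i) (ℤ.+-monoˡ-< i (-<+ {n = 0}))

step-right : ∀ A B m → f 1 1 (config A B (+ m)) ≡ config A (ℕ.suc B) (+ m - + B - + 1)
step-right A B m = trans (f-right 1 1 (ℤ.i≤j+i _ (+ m)))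
  (cong₂ (λ y z → (- + A , y , z)) (cong +_ (ℕ.+-comm B 1)) (shift (+ m) (+ A) (+ B)))
  where
  shift : ∀ d A B → d + (- A + B) - B ≡ (d - B - + 1) + (- A + (+ 1 + B))
  shift = solve-∀

step-left : ∀ A B k → f 1 1 (config A B -[1+ k ]) ≡ config (ℕ.suc A) B (-[1+ k ] + + A + + 2)
step-left A B k = trans (f-left 1 1 (-[1+k]+i<i k (- + A + + B)))
  (cong₂ (λ x z → (x , + B , z)) (left (+ A)) (shift -[1+ k ] (+ A) (+ B)))
  where
  left : ∀ A → - A - + 1 ≡ - (+ 1 + A)
  left = solve-∀
  shift : ∀ d A B → d + (- A + B) - - A + + 1 ≡ (d + A + + 2) + (- (+ 1 + A) + B)
  shift = solve-∀

-- Twice d telescopes: each right move lowers d by B + 1, each left move raises it by A + 2.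
potential : ℕ → ℕ → ℕ → ℤ
potential n A B = + A * + A + + 3 * + A - + B * + B - + B - (+ n * + n + + n)

record Invariant (n A B : ℕ) (d : ℤ) : Set where
  field
    energy : + 2 * d ≡ potential n A B
    d+B≥0  : 0ℤ ≤ d + + B
    A-d≥0  : 0ℤ ≤ + A - d
    A≤n+B  : A ℕ.≤ n ℕ.+ B
open Invariant

potential-suc-right : ∀ n A B → potential n A (ℕ.suc B) ≡ potential n A B - + 2 * (+ B + + 1)
potential-suc-right n A B = identity (+ n) (+ A) (+ B)
  where
  identity : ∀ N A B → A * A + + 3 * A - (+ 1 + B) * (+ 1 + B) - (+ 1 + B) - (N * N + N)
                     ≡ A * A + + 3 * A - B * B - B - (N * N + N) - + 2 * (B + + 1)
  identity = solve-∀

potential-suc-left : ∀ n A B → potential n (ℕ.suc A) B ≡ potential n A B + + 2 * (+ A + + 2)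
potential-suc-left n A B = identity (+ n) (+ A) (+ B)
  where
  identity : ∀ N A B → (+ 1 + A) * (+ 1 + A) + + 3 * (+ 1 + A) - B * B - B - (N * N + N)
                     ≡ A * A + + 3 * A - B * B - B - (N * N + N) + + 2 * (A + + 2)
  identity = solve-∀

potential-tight : ∀ n B → potential n (n ℕ.+ B) B ≡ + 2 * + (n ℕ.+ B ℕ.* ℕ.suc n)
potential-tight n B = trans (identity (+ n) (+ B)) (cong (λ e → + 2 * (+ n + e)) (sym (ℤ.pos-* B (ℕ.suc n))))
  where
  identity : ∀ N B → (N + B) * (N + B) + + 3 * (N + B) - B * B - B - (N * N + N) ≡ + 2 * (N + B * (+ 1 + N))
  identity = solve-∀

d-tight : ∀ {n B d} → Invariant n (n ℕ.+ B) B d → d ≡ + (n ℕ.+ B ℕ.* ℕ.suc n)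
d-tight {n} {B} {d} inv = ℤ.*-cancelˡ-≡ (+ 2) d _ (trans (energy inv) (potential-tight n B))

invariant-initial : ∀ n → Invariant n n 0 (+ n)
invariant-initial n = record
  { energy = identity (+ n)
  ; d+B≥0  = +≤+ ℕ.z≤n
  ; A-d≥0  = ℤ.i≤j⇒0≤j-i (ℤ.≤-refl {+ n})
  ; A≤n+B  = ℕ.m≤m+n n 0
  }
  where
  identity : ∀ N → + 2 * N ≡ N * N + + 3 * N - + 0 * + 0 - + 0 - (N * N + N)
  identity = solve-∀

invariant-right : ∀ {n A B} m → Invariant n A B (+ m) → Invariant n A (ℕ.suc B) (+ m - + B - + 1)
invariant-right {n} {A} {B} m inv = record
  { energy = begin
      + 2 * (+ m - + B - + 1)              ≡⟨ distrib (+ m) (+ B) ⟩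
      + 2 * + m - + 2 * (+ B + + 1)        ≡⟨ cong (_- + 2 * (+ B + + 1)) (energy inv) ⟩
      potential n A B - + 2 * (+ B + + 1)  ≡⟨ sym (potential-suc-right n A B) ⟩
      potential n A (ℕ.suc B)              ∎
  ; d+B≥0  = subst (0ℤ ≤_) (lower (+ m) (+ B)) (+≤+ ℕ.z≤n)
  ; A-d≥0  = subst (0ℤ ≤_) (upper (+ A) (+ m) (+ B)) (ℤ.+-mono-≤ (A-d≥0 inv) (+≤+ ℕ.z≤n))
  ; A≤n+B  = ℕ.≤-trans (A≤n+B inv) (ℕ.+-monoʳ-≤ n (ℕ.n≤1+n B))
  }
  where
  open ≡-Reasoning
  distrib : ∀ d B → + 2 * (d - B - + 1) ≡ + 2 * d - + 2 * (B + + 1)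
  distrib = solve-∀
  lower : ∀ d B → d ≡ (d - B - + 1) + (+ 1 + B)
  lower = solve-∀
  upper : ∀ A d B → (A - d) + (B + + 1) ≡ A - (d - B - + 1)
  upper = solve-∀

invariant-left : ∀ {n A B} k → Invariant n A B -[1+ k ] → Invariant n (ℕ.suc A) B (-[1+ k ] + + A + + 2)
invariant-left {n} {A} {B} k inv = record
  { energy = begin
      + 2 * (-[1+ k ] + + A + + 2)              ≡⟨ distrib -[1+ k ] (+ A) ⟩
      + 2 * -[1+ k ] + + 2 * (+ A + + 2)        ≡⟨ cong (_+ + 2 * (+ A + + 2)) (energy inv) ⟩
      potential n A B + + 2 * (+ A + + 2)       ≡⟨ sym (potential-suc-left n A B) ⟩
      potential n (ℕ.suc A) B                   ∎
  ; d+B≥0  = subst (0ℤ ≤_) (lower -[1+ k ] (+ A) (+ B)) (ℤ.+-mono-≤ (d+B≥0 inv) (+≤+ ℕ.z≤n))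
  ; A-d≥0  = subst (0ℤ ≤_) (upper (+ A) (+ k)) (+≤+ ℕ.z≤n)
  ; A≤n+B  = ℕ.≤∧≢⇒< (A≤n+B inv) not-tight
  }
  where
  open ≡-Reasoning
  distrib : ∀ d A → + 2 * (d + A + + 2) ≡ + 2 * d + + 2 * (A + + 2)
  distrib = solve-∀
  lower : ∀ d A B → (d + B) + (A + + 2) ≡ (d + A + + 2) + B
  lower = solve-∀
  upper : ∀ A K → K ≡ (+ 1 + A) - (- (+ 1 + K) + A + + 2)
  upper = solve-∀
  not-tight : A ≢ n ℕ.+ B
  not-tight A≡n+B with d-tight (subst (λ a → Invariant n a B -[1+ k ]) A≡n+B inv)
  ... | ()

reachable : ∀ n t → ∃[ A ] ∃[ B ] ∃[ d ] σ n t ≡ config A B d × Invariant n A B d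
reachable n ℕ.zero = n , 0 , + n , cong (λ z → (- + n , + 0 , z)) (initial (+ n)) , invariant-initial n
  where
  initial : ∀ N → + 0 ≡ N + (- N + + 0)
  initial = solve-∀
reachable n (ℕ.suc t) with reachable n t
... | A , B , + m , σ≡ , inv =
  A , ℕ.suc B , _ , trans (cong (f 1 1) σ≡) (step-right A B m) , invariant-right m inv
... | A , B , -[1+ k ] , σ≡ , inv =
  ℕ.suc A , B , _ , trans (cong (f 1 1) σ≡) (step-left A B k) , invariant-left k inv

energy-defect-vanishes : ∀ {n A B d} → Invariant n A B d → ∀ i → i + (potential n A B - + 2 * d) ≡ i
energy-defect-vanishes inv i = trans (cong (_+_ i) (ℤ.i≡j⇒i-j≡0 (sym (energy inv)))) (ℤ.+-identityʳ i)

square-difference-bound : ∀ {n A B d} → NonZero n → Invariant n A B d →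
  (- + A) * (- + A) - + B * + B < + n * + n + + n
square-difference-bound {n} {A} {B} {d} n≢0 inv with B ℕ.<? A
... | yes B<A =
  <-of-positive-gap (trans (sym (energy-defect-vanishes inv _)) (gap (+ n) (+ A) (+ B) d))
    (ℤ.+-mono-<-≤ (i<j⇒0<j-i (+<+ B<A)) (ℤ.+-mono-≤ (A-d≥0 inv) (A-d≥0 inv)))
  where
  gap : ∀ N A B d → (N * N + N) + (A * A + + 3 * A - B * B - B - (N * N + N) - + 2 * d)
                  ≡ ((- A) * (- A) - B * B) + ((A - B) + ((A - d) + (A - d)))
  gap = solve-∀
... | no B≮A =
  <-of-positive-gap (gap (+ n) (+ A) (+ B))
    (ℤ.+-mono-<-≤ 0<n²+n (ℤ.i≤j⇒0≤j-i A²≤B²))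
  where
  gap : ∀ N A B → N * N + N ≡ ((- A) * (- A) - B * B) + ((N * N + N) + (B * B - A * A))
  gap = solve-∀
  A≤B : A ℕ.≤ B
  A≤B = ℕ.≮⇒≥ B≮A
  A²≤B² : + A * + A ≤ + B * + B
  A²≤B² = subst₂ _≤_ (ℤ.pos-* A A) (ℤ.pos-* B B) (+≤+ (ℕ.*-mono-≤ A≤B A≤B))
  0<n²+n : 0ℤ < + n * + n + + n
  0<n²+n = subst (λ e → 0ℤ < e + + n) (ℤ.pos-* n n)
             (+<+ (ℕ.<-≤-trans (ℕ.>-nonZero⁻¹ n {{n≢0}}) (ℕ.m≤n+m n (n ℕ.* n))))

shifted-square-difference-bound : ∀ {n A B d} → NonZero n → Invariant n A B d →
  (- + A - + 1) * (- + A - + 1) - (+ B - + 1) * (+ B - + 1) > + n * + n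
shifted-square-difference-bound {n} {A} {B} {d} n≢0 inv =
  <-of-positive-gap (trans (gap (+ n) (+ A) (+ B) d) (energy-defect-vanishes inv _)) gap-positive
  where
  gap : ∀ N A B d → (- A - + 1) * (- A - + 1) - (B - + 1) * (B - + 1)
                  ≡ (N * N + ((N + B - A) + ((d + B) + (d + B))))
                    + (A * A + + 3 * A - B * B - B - (N * N + N) - + 2 * d)
  gap = solve-∀
  gap-positive : 0ℤ < (+ n + + B - + A) + ((d + + B) + (d + + B))
  gap-positive with ℕ.m≤n⇒m<n∨m≡n (A≤n+B inv)
  ... | inj₁ A<n+B = ℤ.+-mono-<-≤ (i<j⇒0<j-i (+<+ A<n+B)) (ℤ.+-mono-≤ (d+B≥0 inv) (d+B≥0 inv))
  ... | inj₂ refl  = ℤ.+-mono-≤-< (ℤ.i≤j⇒0≤j-i (ℤ.≤-refl {+ n + + B})) (ℤ.+-mono-< 0<d+B 0<d+B)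
    where
    0<d+B : 0ℤ < d + + B
    0<d+B = subst (λ e → 0ℤ < e + + B) (sym (d-tight inv))
              (+<+ (ℕ.<-≤-trans (ℕ.>-nonZero⁻¹ n {{n≢0}}) (ℕ.≤-trans (ℕ.m≤m+n n _) (ℕ.m≤m+n _ B))))

proposition3p4 : (n : ℕ) → NonZero n → (t : ℕ) →
    let (x , y , z) = σ n t in
    ((x * x - y * y) < (+ n * + n + + n)) ×
    (((x - + 1) * (x - + 1) - (y - + 1) * (y - + 1)) > (+ n * + n))
proposition3p4 n n≢0 t with reachable n t
... | A , B , d , σ≡ , inv rewrite σ≡ =
  square-difference-bound n≢0 inv , shifted-square-difference-bound n≢0 inv
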